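{- Let $n\ge1$ and $v\in\mathcal{P}_n$. Let $G_v$ be the graph with vertex set $\{1,\dots,n\}$ in which $\{i,j\}$ is an edge if and only if $v_{ij}>0$. Then $G_v$ is the union of a complete multipartite graph (on some subset of the vertices) and some isolated nodes.
   Context: $\mathcal{P}_n=\{v\in\mathbb{R}_{\ge0}^{\binom n2}: v_{ij}v_{kl}\le v_{ik}v_{jl}+v_{il}v_{jk}\text{ for all four distinct }i,j,k,l\in[n]\}$, with coordinates of $\mathbb{R}^{\binom n2}$ indexed by unordered pairs $\{i,j\}\subset[n]$ (so $v_{ij}=v_{ji}$). -}

module Defs where

open import Level using (Level; _⊔_; suc)
open import Algebra.Bundles using (CommutativeRing)
open import Relation.Binary.Core using (Rel)
open import Relation.Binary.Structures using (IsStrictTotalOrder)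
open import Data.Fin using (Fin)
open import Data.Bool using (Bool; true)
open import Data.Product using (Σ; ∃; _×_)
open import Data.Sum using (_⊎_)
open import Relation.Binary.PropositionalEquality using (_≡_)
open import Relation.Nullary using (¬_)
open import Function.Bundles using (_⇔_)

-- The paper works over ℝ, which agda-stdlib lacks.  We state the result over
-- an arbitrary ordered field (ℝ is an instance), using the standard axioms.
record OrderedField (c ℓ : Level) : Set (suc (c ⊔ ℓ)) where
  field
    commRing : CommutativeRing c ℓ
  open CommutativeRing commRing public
  field
    _<_            : Rel Carrier ℓ
    isStrictTotalOrder : IsStrictTotalOrder _≈_ _<_
    +-mono-<       : ∀ {x y} z → x < y → (x + z) < (y + z)
    *-pos          : ∀ {x y} → 0# < x → 0# < y → 0# < (x * y)
    inverse        : ∀ x → ¬ (x ≈ 0#) → Σ Carrier (λ y → (x * y) ≈ 1#)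
    0≉1            : ¬ (0# ≈ 1#)

  _≤_ : Rel Carrier ℓ
  x ≤ y = (x < y) ⊎ (x ≈ y)

module _ {c ℓ : Level} (F : OrderedField c ℓ) where
  open OrderedField F

  -- A vector v ∈ ℝ^(n choose 2), coordinates indexed by unordered pairs {i,j},
  -- is represented by a symmetric function Fin n → Fin n → F (diagonal unused).
  Symmetric : {n : _} → (Fin n → Fin n → Carrier) → Set ℓ
  Symmetric {n} v = ∀ (i j : Fin n) → v i j ≈ v j i

  InP : {n : _} → (Fin n → Fin n → Carrier) → Set ℓ
  InP {n} v =
    (∀ (i j : Fin n) → ¬ (i ≡ j) → 0# ≤ v i j) ×
    (∀ (i j k l : Fin n) →
       ¬ (i ≡ j) → ¬ (i ≡ k) → ¬ (i ≡ l) → ¬ (j ≡ k) → ¬ (j ≡ l) → ¬ (k ≡ l) →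
       (v i j * v k l) ≤ ((v i k * v j l) + (v i l * v j k)))

  EdgeG : {n : _} → (Fin n → Fin n → Carrier) → Fin n → Fin n → Set ℓ
  EdgeG v i j = 0# < v i j

IsCompleteMultipartitePlusIsolated : {ℓ : Level} (n : _) → (Fin n → Fin n → Set ℓ) → Set ℓ
IsCompleteMultipartitePlusIsolated n E =
  Σ (Fin n → Bool) λ S → Σ (Fin n → Fin n) λ part →
    ∀ (i j : Fin n) → ¬ (i ≡ j) →
      E i j ⇔ ((S i ≡ true) × (S j ≡ true) × ¬ (part i ≡ part j))

-- If v_ik and v_jl are positive for distinct i, j, k, l, the four-point
-- inequality v_ik v_jl ≤ v_ij v_kl + v_il v_kj forbids v_ij = v_jk = 0.
-- Hence non-adjacency is transitive through every non-isolated vertex, so on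
-- the non-isolated vertices it is an equivalence relation, whose classes are
-- the parts of a complete multipartite graph.
module Submission where

open import Defs
open import Level using (Level)
open import Data.Nat using (ℕ; _≤_)
open import Data.Bool using (Bool; true)
open import Data.Fin using (Fin; Fin′; inject; fromℕ<) renaming (_<_ to _<ᶠ_)
open import Data.Fin.Properties
  using (¬∀⟶∃¬-smallest; <-cmp; any?; toℕ-injective; toℕ-inject; toℕ-fromℕ<)
  renaming (_≟_ to _≟ᶠ_)
open import Data.Product using (∃; _×_; _,_; proj₁; proj₂)
open import Data.Sum using (inj₁; inj₂)
open import Data.Empty using (⊥; ⊥-elim)
open import Function using (_∘_; id)
open import Function.Bundles using (_⇔_; mk⇔; module Equivalence)
open import Relation.Binary.Core using (Rel)
open import Relation.Binary.Definitions using (tri<; tri≈; tri>)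
open import Relation.Binary.Structures using (IsDecEquivalence; IsStrictTotalOrder)
open import Relation.Binary.PropositionalEquality using (_≡_; refl; sym; trans; subst)
open import Relation.Nullary using (¬_; Dec; does; yes; no)
open import Relation.Nullary.Decidable using (¬?; _×-dec_; _→-dec_; decidable-stable)
open import Relation.Unary using (Pred; Decidable; _⊆_)

IsLeast : ∀ {n ℓ} → Pred (Fin n) ℓ → Pred (Fin n) ℓ
IsLeast P i = P i × (∀ (j : Fin′ i) → ¬ P (inject j))

least : ∀ {n ℓ} {P : Pred (Fin n) ℓ} → Decidable P → ∃ P → ∃ (IsLeast P)
least {n} {P = P} P? (i , Pi) with ¬∀⟶∃¬-smallest n (¬_ ∘ P) (¬? ∘ P?) (λ ¬P → ¬P i Pi)
... | j , ¬¬Pj , below = j , decidable-stable (P? j) ¬¬Pj , below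

inject-fromℕ< : ∀ {n} {i j : Fin n} (i<j : i <ᶠ j) → inject {i = j} (fromℕ< i<j) ≡ i
inject-fromℕ< i<j = toℕ-injective (trans (toℕ-inject (fromℕ< i<j)) (toℕ-fromℕ< i<j))

IsLeast-unique : ∀ {n ℓ} {P Q : Pred (Fin n) ℓ} → P ⊆ Q → Q ⊆ P →
                 ∀ {i j} → IsLeast P i → IsLeast Q j → i ≡ j
IsLeast-unique {P = P} {Q} P⇒Q Q⇒P {i} {j} (Pi , P-below-i) (Qj , Q-below-j) with <-cmp i j
... | tri< i<j _ _ = ⊥-elim (Q-below-j (fromℕ< i<j) (subst Q (sym (inject-fromℕ< i<j)) (P⇒Q Pi)))
... | tri≈ _ i≡j _ = i≡j
... | tri> _ _ j<i = ⊥-elim (P-below-i (fromℕ< j<i) (subst P (sym (inject-fromℕ< j<i)) (Q⇒P Qj)))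

module Representatives {n ℓ} {_~_ : Rel (Fin n) ℓ} (isDecEquivalence : IsDecEquivalence _~_) where
  open IsDecEquivalence isDecEquivalence
    renaming (refl to ~-refl; sym to ~-sym; trans to ~-trans)

  leastInClass : ∀ x → ∃ (IsLeast (x ~_))
  leastInClass x = least (x ≟_) (x , ~-refl)

  rep : Fin n → Fin n
  rep x = proj₁ (leastInClass x)

  ~-rep : ∀ x → x ~ rep x
  ~-rep x = proj₁ (proj₂ (leastInClass x))

  rep-≡⇔~ : ∀ x y → rep x ≡ rep y ⇔ x ~ y
  rep-≡⇔~ x y = mk⇔
    (λ rx≡ry → ~-trans (~-rep x) (subst (_~ y) (sym rx≡ry) (~-sym (~-rep y))))
    (λ x~y → IsLeast-unique {P = x ~_} {Q = y ~_} (~-trans (~-sym x~y)) (~-trans x~y)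
                            (proj₂ (leastInClass x)) (proj₂ (leastInClass y)))

module Graph {n ℓ} (E : Rel (Fin n) ℓ) (E? : ∀ i j → Dec (E i j)) (E-sym : ∀ {i j} → E i j → E j i) where

  Adj : Rel (Fin n) ℓ
  Adj i j = ¬ i ≡ j × E i j

  Adj? : ∀ i j → Dec (Adj i j)
  Adj? i j = ¬? (i ≟ᶠ j) ×-dec E? i j

  Adj-sym : ∀ {i j} → Adj i j → Adj j i
  Adj-sym (i≢j , Eij) = i≢j ∘ sym , E-sym Eij

  Adj-irrefl : ∀ {i} → ¬ Adj i i
  Adj-irrefl (i≢i , _) = i≢i refl

  NonIsolated : Pred (Fin n) ℓ
  NonIsolated i = ∃ (Adj i)

  NonIsolated? : Decidable NonIsolated
  NonIsolated? i = any? (Adj? i)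

  nonIsolated : Fin n → Bool
  nonIsolated i = does (NonIsolated? i)

  nonIsolated≡true⇔ : ∀ {i} → nonIsolated i ≡ true ⇔ NonIsolated i
  nonIsolated≡true⇔ {i} with NonIsolated? i
  ... | yes ni  = mk⇔ (λ _ → ni) (λ _ → refl)
  ... | no ¬ni = mk⇔ (λ ()) (⊥-elim ∘ ¬ni)

  NonAdjacencyTransitive : Set ℓ
  NonAdjacencyTransitive = ∀ {i j k} → NonIsolated j → ¬ Adj i j → ¬ Adj j k → ¬ Adj i k

  -- The isolated vertices form one extra class, which makes SamePart transitive.
  SamePart : Rel (Fin n) ℓ
  SamePart i j = ¬ Adj i j × (NonIsolated i → NonIsolated j) × (NonIsolated j → NonIsolated i)

  module _ (transitive : NonAdjacencyTransitive) where

    SamePart-isDecEquivalence : IsDecEquivalence SamePart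
    SamePart-isDecEquivalence = record
      { isEquivalence = record
        { refl  = Adj-irrefl , id , id
        ; sym   = λ (¬ij , i⇒j , j⇒i) → ¬ij ∘ Adj-sym , j⇒i , i⇒j
        ; trans = λ (¬ij , i⇒j , j⇒i) (¬jk , j⇒k , k⇒j) →
                    ¬Adj-through ¬ij ¬jk i⇒j , j⇒k ∘ i⇒j , j⇒i ∘ k⇒j
        }
      ; _≟_ = λ i j → ¬? (Adj? i j) ×-dec (NonIsolated? i →-dec NonIsolated? j)
                                   ×-dec (NonIsolated? j →-dec NonIsolated? i)
      }
      where
      ¬Adj-through : ∀ {i j k} → ¬ Adj i j → ¬ Adj j k → (NonIsolated i → NonIsolated j) → ¬ Adj i k
      ¬Adj-through {j = j} {k} ¬ij ¬jk i⇒j Aik with NonIsolated? j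
      ... | yes nj  = transitive nj ¬ij ¬jk Aik
      ... | no ¬nj = ¬nj (i⇒j (k , Aik))

    open Representatives SamePart-isDecEquivalence

    completeMultipartitePlusIsolated : IsCompleteMultipartitePlusIsolated n E
    completeMultipartitePlusIsolated = nonIsolated , rep , λ i j i≢j → mk⇔ (edge⇒ i≢j) (edge⇐ i≢j)
      where
      open Equivalence

      edge⇒ : ∀ {i j} → ¬ i ≡ j → E i j →
              nonIsolated i ≡ true × nonIsolated j ≡ true × ¬ rep i ≡ rep j
      edge⇒ {i} {j} i≢j Eij =
        from nonIsolated≡true⇔ (j , Aij) , from nonIsolated≡true⇔ (i , Adj-sym Aij) ,
        λ rep≡ → proj₁ (to (rep-≡⇔~ i j) rep≡) Aij
        where Aij = i≢j , Eij

      edge⇐ : ∀ {i j} → ¬ i ≡ j →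
              nonIsolated i ≡ true × nonIsolated j ≡ true × ¬ rep i ≡ rep j → E i j
      edge⇐ {i} {j} i≢j (ni , nj , rep≢) = decidable-stable (E? i j) λ ¬Eij →
        rep≢ (from (rep-≡⇔~ i j) ((¬Eij ∘ proj₂) , (λ _ → to nonIsolated≡true⇔ nj)
                                                  , (λ _ → to nonIsolated≡true⇔ ni)))

module FourPointCondition {c ℓ} (F : OrderedField c ℓ) {n : ℕ} {v : Fin n → Fin n → OrderedField.Carrier F}
    (v-sym : Symmetric F v) (v∈P : InP F v) where
  open OrderedField F
    using (_≈_; _<_; _+_; _*_; 0#; setoid; isStrictTotalOrder;
           *-pos; zeroˡ; zeroʳ; +-identityʳ; +-cong; *-congˡ; *-congʳ)
    renaming (refl to ≈-refl; sym to ≈-sym; trans to ≈-trans)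
  open IsStrictTotalOrder isStrictTotalOrder using (irrefl; compare; <-respʳ-≈) renaming (trans to <-trans)
  open import Relation.Binary.Reasoning.Setoid setoid

  0<? : ∀ x → Dec (0# < x)
  0<? x with compare 0# x
  ... | tri< 0<x _ _ = yes 0<x
  ... | tri≈ ¬0<x _ _ = no ¬0<x
  ... | tri> ¬0<x _ _ = no ¬0<x

  <-≤-trans : ∀ {x y z} → x < y → OrderedField._≤_ F y z → x < z
  <-≤-trans x<y (inj₁ y<z) = <-trans x<y y<z
  <-≤-trans x<y (inj₂ y≈z) = <-respʳ-≈ y≈z x<y

  open Graph (EdgeG F v) (λ i j → 0<? (v i j)) (λ {i} {j} → <-respʳ-≈ (v-sym i j)) public

  nonAdjacent⇒zero : ∀ {i j} → ¬ i ≡ j → ¬ Adj i j → v i j ≈ 0#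
  nonAdjacent⇒zero {i} {j} i≢j ¬Aij with proj₁ v∈P i j i≢j
  ... | inj₁ 0<vij = ⊥-elim (¬Aij (i≢j , 0<vij))
  ... | inj₂ 0≈vij = ≈-sym 0≈vij

  fourPointObstruction : ∀ {i j k l} → ¬ i ≡ k → ¬ i ≡ j → ¬ i ≡ l → ¬ k ≡ j → ¬ k ≡ l → ¬ j ≡ l →
                         0# < v i k → 0# < v j l → v i j ≈ 0# → v k j ≈ 0# → ⊥
  fourPointObstruction {i} {j} {k} {l} i≢k i≢j i≢l k≢j k≢l j≢l 0<vik 0<vjl vij≈0 vkj≈0 =
    irrefl ≈-refl (<-respʳ-≈ rhs≈0 (<-≤-trans (*-pos 0<vik 0<vjl) fourPoint))
    where
    fourPoint : OrderedField._≤_ F (v i k * v j l) (v i j * v k l + v i l * v k j)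
    fourPoint = proj₂ v∈P i k j l i≢k i≢j i≢l k≢j k≢l j≢l

    rhs≈0 : v i j * v k l + v i l * v k j ≈ 0#
    rhs≈0 = begin
      v i j * v k l + v i l * v k j ≈⟨ +-cong (*-congʳ vij≈0) (*-congˡ vkj≈0) ⟩
      0# * v k l + v i l * 0#       ≈⟨ +-cong (zeroˡ (v k l)) (zeroʳ (v i l)) ⟩
      0# + 0#                       ≈⟨ +-identityʳ 0# ⟩
      0#                            ∎

  nonAdjacencyTransitive : NonAdjacencyTransitive
  nonAdjacencyTransitive {i} {j} {k} (l , Ajl@(j≢l , 0<vjl)) ¬Aij ¬Ajk Aik@(i≢k , 0<vik)
    with i ≟ᶠ j | j ≟ᶠ k | i ≟ᶠ l | k ≟ᶠ l
  ... | yes refl | _        | _        | _        = ¬Ajk Aik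
  ... | no _     | yes refl | _        | _        = ¬Aij Aik
  ... | no _     | no _     | yes refl | _        = ¬Aij (Adj-sym Ajl)
  ... | no _     | no _     | no _     | yes refl = ¬Ajk Ajl
  ... | no i≢j   | no j≢k   | no i≢l   | no k≢l   =
    fourPointObstruction i≢k i≢j i≢l (j≢k ∘ sym) k≢l j≢l 0<vik 0<vjl
      (nonAdjacent⇒zero i≢j ¬Aij) (≈-trans (v-sym _ _) (nonAdjacent⇒zero j≢k ¬Ajk))

proposition5p1 : {c ℓ : Level} (F : OrderedField c ℓ) (n : ℕ) → 1 ≤ n →
    (v : Fin n → Fin n → OrderedField.Carrier F) →
    Symmetric F v → InP F v →
    IsCompleteMultipartitePlusIsolated n (EdgeG F v)
proposition5p1 F n _ v v-sym v∈P = completeMultipartitePlusIsolated nonAdjacencyTransitive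
  where open FourPointCondition F v-sym v∈P
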